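{- Let $F$ be a Boolean formula over $n$ variables and let $1\le m\le n$. If $\#F\le 2^{m-2}$, then $\varphi_{stock}^F(m)$ is true.
   Context: $\#F$ denotes the number of satisfying assignments of $F$ in $\{0,1\}^n$. For $n,m\ge1$, $\mathcal{H}(n,m,2)$ is a fixed pairwise independent family of hash functions $\{0,1\}^n\to\{0,1\}^m$: for distinct $y_1,y_2$ and any $\alpha_1,\alpha_2$, $\Pr[h(y_1)=\alpha_1\wedge h(y_2)=\alpha_2]=2^{ -2m}$ for uniform $h$. Each member is specified by 2 coefficients in $GF(2^{\max(n,m)})$, and $\exists h$ quantifies over these coefficient bits. Define $$\varphi_{stock}^F(m):=\exists h_1,\dots,h_m\in\mathcal{H}(n,m,2)\ \forall z_1,z_2\in\{0,1\}^n\ \bigvee_{i=1}^m\big(F(z_1)\wedge z_1\neq z_2\wedge h_i(z_1)=h_i(z_2)\rightarrow\neg F(z_2)\big).$$ -}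

module Defs where

open import Data.Bool using (Bool; true; false)
import Data.Bool as B
open import Data.Nat using (ℕ; zero; suc; _*_; _^_; _+_)
open import Data.Fin using (Fin)
open import Data.List using (List; []; _∷_; map; _++_; length; filter)
open import Data.Vec using (Vec; []; _∷_)
open import Data.Vec.Properties using (≡-dec)
open import Data.Product using (_×_; _,_)
open import Relation.Binary.PropositionalEquality using (_≡_; _≢_)
open import Relation.Nullary using (Dec; ¬_)
open import Relation.Nullary.Decidable using (_×-dec_)

BitVec : ℕ → Set
BitVec n = Vec Bool n

-- A Boolean formula over n variables, identified with the Boolean
-- function {0,1}^n → {0,1} it computes.
Formula : ℕ → Set
Formula n = BitVec n → Bool

_≟v_ : ∀ {n} → (x y : BitVec n) → Dec (x ≡ y)
_≟v_ = ≡-dec B._≟_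

allBitVecs : (n : ℕ) → List (BitVec n)
allBitVecs zero = [] ∷ []
allBitVecs (suc n) = map (false ∷_) (allBitVecs n) ++ map (true ∷_) (allBitVecs n)

#sat : ∀ {n} → Formula n → ℕ
#sat {n} F = length (filter (λ x → F x B.≟ true) (allBitVecs n))

allFin : (K : ℕ) → List (Fin K)
allFin K = Data.List.allFin K

-- A hash family {0,1}^n → {0,1}^m, given by an index set Fin K of members
-- (h is drawn uniformly from the K members).
HashFamily : ℕ → ℕ → ℕ → Set
HashFamily n m K = Fin K → BitVec n → BitVec m

-- Pairwise independence: for distinct y₁ y₂ and all α₁ α₂,
-- Pr_h[h(y₁)=α₁ ∧ h(y₂)=α₂] = 2^{-2m}, i.e.
-- #{i | H i y₁ = α₁ ∧ H i y₂ = α₂} * 2^{2m} = K.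
PairwiseIndependent : ∀ {n m K} → HashFamily n m K → Set
PairwiseIndependent {n} {m} {K} H =
  ∀ (y₁ y₂ : BitVec n) → y₁ ≢ y₂ → ∀ (α₁ α₂ : BitVec m) →
    length (filter (λ i → (H i y₁ ≟v α₁) ×-dec (H i y₂ ≟v α₂)) (allFin K))
      * 2 ^ (2 * m) ≡ K

phiStock : ∀ {n m K} → HashFamily n m K → Formula n → Set
phiStock {n} {m} {K} H F =
  Data.Product.Σ (Fin m → Fin K) λ hs →
    ∀ (z₁ z₂ : BitVec n) →
      Data.Product.Σ (Fin m) λ i →
        (F z₁ ≡ true × z₁ ≢ z₂ × H (hs i) z₁ ≡ H (hs i) z₂) → F z₂ ≡ false

-- Summing pairwise independence over the diagonal α₁ = α₂ shows that two distinct points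
-- collide under exactly K / 2^m members of the family. By averaging, some member collides on at
-- most a 2^-m fraction of any list of distinct pairs. Applied twice to the ordered pairs of
-- distinct satisfying assignments, this yields members h₁, h₂ under which at most
-- #F² / 4^m < 1 such pairs collide simultaneously, as soon as #F < 2^m. Using h₁ for the
-- first slot and h₂ for all others, every such pair is separated by one of the slots.
-- For m = 1 the hypothesis forces #F = 0 and there is nothing to separate.
module Submission where

open import Defs
open import Data.Nat using (ℕ; zero; suc; _+_; _*_; _^_; _≤_; _<_; _≤?_; z≤n; s≤s)
open import Data.Nat.Properties
open import Data.Nat.ListAction using (sum)
open import Algebra.Properties.CommutativeSemigroup +-commutativeSemigroup using (interchange)
open import Data.Bool using (true; false)
import Data.Bool as Bool
open import Data.Bool.Properties using (¬-not)
open import Data.Fin using (Fin)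
import Data.Fin as Fin
open import Data.List using (List; []; _∷_; _++_; map; length; filter; tabulate; cartesianProduct)
open import Data.List.Properties
  using ( map-cong; length-map; length-++; length-filter; length-tabulate
        ; filter-≐; filter-none; filter-accept; filter-reject; filter-some)
open import Data.List.Relation.Unary.All as All using (All; []; _∷_)
open import Data.List.Relation.Unary.All.Properties using (all-filter; filter⁺)
open import Data.List.Relation.Unary.Any as Any using (Any; here; there)
open import Data.List.Relation.Unary.AllPairs using ([]; _∷_)
open import Data.List.Relation.Unary.Unique.Propositional using (Unique)
import Data.List.Relation.Unary.Unique.Propositional.Properties as Unique
open import Data.List.Membership.Propositional using (_∈_; lose)
open import Data.List.Membership.Propositional.Properties
  using (∈-map⁺; ∈-map⁻; ∈-++⁺ˡ; ∈-++⁺ʳ; ∈-filter⁺; ∈-cartesianProduct⁺)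
open import Data.Vec using ([]; _∷_)
open import Data.Vec.Properties using (∷-injectiveʳ)
open import Data.Product using (Σ; ∃; ∃₂; _×_; _,_; proj₁; proj₂; uncurry)
open import Data.Empty using (⊥; ⊥-elim)
open import Function using (_∘_; id)
open import Relation.Binary.Definitions using (DecidableEquality)
open import Relation.Binary.PropositionalEquality
open import Relation.Nullary using (Dec; yes; no; ¬?)
open import Relation.Nullary.Decidable using (_×-dec_)
open import Relation.Unary using (Decidable)

private variable
  A B : Set

indicator : {P : Set} → Dec P → ℕ
indicator (yes _) = 1
indicator (no _)  = 0

length-filter≡sum-indicator : {P : A → Set} (P? : Decidable P) (xs : List A) →
  length (filter P? xs) ≡ sum (map (indicator ∘ P?) xs)
length-filter≡sum-indicator P? [] = refl
length-filter≡sum-indicator P? (x ∷ xs) with P? x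
... | yes _ = cong suc (length-filter≡sum-indicator P? xs)
... | no _  = length-filter≡sum-indicator P? xs

sum-map-+ : (f g : A → ℕ) (xs : List A) →
  sum (map (λ x → f x + g x) xs) ≡ sum (map f xs) + sum (map g xs)
sum-map-+ f g [] = refl
sum-map-+ f g (x ∷ xs) =
  trans (cong (f x + g x +_) (sum-map-+ f g xs)) (interchange (f x) (g x) _ _)

sum-map-zero : (xs : List A) → sum (map (λ _ → 0) xs) ≡ 0
sum-map-zero [] = refl
sum-map-zero (x ∷ xs) = sum-map-zero xs

sum-map-comm : (g : A → B → ℕ) (xs : List A) (ys : List B) →
  sum (map (λ x → sum (map (g x) ys)) xs) ≡ sum (map (λ y → sum (map (λ x → g x y) xs)) ys)
sum-map-comm g [] ys = sym (sum-map-zero ys)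
sum-map-comm g (x ∷ xs) ys = begin
  sum (map (g x) ys) + sum (map (λ x → sum (map (g x) ys)) xs)
    ≡⟨ cong (sum (map (g x) ys) +_) (sum-map-comm g xs ys) ⟩
  sum (map (g x) ys) + sum (map (λ y → sum (map (λ x → g x y) xs)) ys)
    ≡⟨ sum-map-+ (g x) (λ y → sum (map (λ x → g x y) xs)) ys ⟨
  sum (map (λ y → sum (map (λ x → g x y) (x ∷ xs))) ys) ∎
  where open ≡-Reasoning

length-filter-comm : {R : A → B → Set} (R? : ∀ x y → Dec (R x y)) (xs : List A) (ys : List B) →
  sum (map (λ x → length (filter (R? x) ys)) xs) ≡
  sum (map (λ y → length (filter (λ x → R? x y) xs)) ys)
length-filter-comm R? xs ys = begin
  sum (map (λ x → length (filter (R? x) ys)) xs)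
    ≡⟨ cong sum (map-cong (λ x → length-filter≡sum-indicator (R? x) ys) xs) ⟩
  sum (map (λ x → sum (map (λ y → indicator (R? x y)) ys)) xs)
    ≡⟨ sum-map-comm (λ x y → indicator (R? x y)) xs ys ⟩
  sum (map (λ y → sum (map (λ x → indicator (R? x y)) xs)) ys)
    ≡⟨ cong sum (map-cong (λ y → length-filter≡sum-indicator (λ x → R? x y) xs) ys) ⟨
  sum (map (λ y → length (filter (λ x → R? x y) xs)) ys) ∎
  where open ≡-Reasoning

sum-map-*≡length-* : (f : A → ℕ) (c d : ℕ) {xs : List A} →
  All (λ x → f x * c ≡ d) xs → sum (map f xs) * c ≡ length xs * d
sum-map-*≡length-* f c d [] = refl
sum-map-*≡length-* f c d {x ∷ xs} (fx*c≡d ∷ rest) =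
  trans (*-distribʳ-+ c (f x) (sum (map f xs))) (cong₂ _+_ fx*c≡d (sum-map-*≡length-* f c d rest))

min≤average : (f : A → ℕ) (x : A) (xs : List A) →
  Any (λ y → length (x ∷ xs) * f y ≤ sum (map f (x ∷ xs))) (x ∷ xs)
min≤average f x [] = here ≤-refl
min≤average f x (y ∷ ys) with length (y ∷ ys) * f x ≤? sum (map f (y ∷ ys))
... | yes L*fx≤S = here (+-monoʳ-≤ (f x) L*fx≤S)
... | no  L*fx≰S =
  there (Any.map (λ L*fz≤S → +-mono-≤ (fz≤fx L*fz≤S) L*fz≤S) (min≤average f y ys))
  where
  fz≤fx : ∀ {z} → length (y ∷ ys) * f z ≤ sum (map f (y ∷ ys)) → f z ≤ f x
  fz≤fx L*fz≤S = <⇒≤ (*-cancelˡ-< (length (y ∷ ys)) _ _ (≤-<-trans L*fz≤S (≰⇒> L*fx≰S)))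

module _ (_≟_ : DecidableEquality A) where

  length-filter-≡-unique : ∀ {v xs} → Unique xs → v ∈ xs → length (filter (v ≟_) xs) ≡ 1
  length-filter-≡-unique {xs = x ∷ xs} (x≢xs ∷ _) (here refl) =
    trans (cong length (filter-accept (x ≟_) refl)) (cong (suc ∘ length) (filter-none (x ≟_) x≢xs))
  length-filter-≡-unique {v} {x ∷ xs} (x≢xs ∷ unique) (there v∈xs) =
    trans (cong length (filter-reject (v ≟_) (λ v≡x → All.lookup x≢xs v∈xs (sym v≡x))))
          (length-filter-≡-unique unique v∈xs)

  length-filter-diagonal : ∀ {u w xs} → Unique xs → u ∈ xs →
    length (filter (λ α → (u ≟ α) ×-dec (w ≟ α)) xs) ≡ indicator (u ≟ w)
  length-filter-diagonal {u} {w} {xs} unique u∈xs with u ≟ w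
  ... | yes refl = trans (cong length (filter-≐ _ (u ≟_) (proj₁ , λ u≡α → u≡α , u≡α) xs))
                         (length-filter-≡-unique unique u∈xs)
  ... | no u≢w = cong length
    (filter-none _ (All.universal (λ α (u≡α , w≡α) → u≢w (trans u≡α (sym w≡α))) xs))

∈-allBitVecs : ∀ {n} (v : BitVec n) → v ∈ allBitVecs n
∈-allBitVecs [] = here refl
∈-allBitVecs {suc n} (false ∷ v) = ∈-++⁺ˡ (∈-map⁺ (false ∷_) (∈-allBitVecs v))
∈-allBitVecs {suc n} (true ∷ v) = ∈-++⁺ʳ (map (false ∷_) (allBitVecs n)) (∈-map⁺ (true ∷_) (∈-allBitVecs v))

allBitVecs-unique : ∀ n → Unique (allBitVecs n)
allBitVecs-unique zero = [] ∷ []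
allBitVecs-unique (suc n) = Unique.++⁺ (Unique.map⁺ ∷-injectiveʳ (allBitVecs-unique n))
                                       (Unique.map⁺ ∷-injectiveʳ (allBitVecs-unique n))
                                       disjoint
  where
  disjoint : ∀ {v} → v ∈ map (false ∷_) (allBitVecs n) × v ∈ map (true ∷_) (allBitVecs n) → ⊥
  disjoint (v∈₀ , v∈₁) with ∈-map⁻ (false ∷_) v∈₀ | ∈-map⁻ (true ∷_) v∈₁
  ... | _ , _ , refl | _ , _ , ()

length-allBitVecs : ∀ n → length (allBitVecs n) ≡ 2 ^ n
length-allBitVecs zero = refl
length-allBitVecs (suc n) = begin
  length (map (false ∷_) (allBitVecs n) ++ map (true ∷_) (allBitVecs n))
    ≡⟨ length-++ (map (false ∷_) (allBitVecs n)) ⟩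
  length (map (false ∷_) (allBitVecs n)) + length (map (true ∷_) (allBitVecs n))
    ≡⟨ cong₂ _+_ (length-map (false ∷_) (allBitVecs n)) (length-map (true ∷_) (allBitVecs n)) ⟩
  length (allBitVecs n) + length (allBitVecs n)
    ≡⟨ cong₂ _+_ (length-allBitVecs n) (trans (length-allBitVecs n) (sym (+-identityʳ (2 ^ n)))) ⟩
  2 ^ n + (2 ^ n + 0) ∎
  where open ≡-Reasoning

length-cartesianProduct : (xs : List A) (ys : List B) →
  length (cartesianProduct xs ys) ≡ length xs * length ys
length-cartesianProduct [] ys = refl
length-cartesianProduct (x ∷ xs) ys =
  trans (length-++ (map (x ,_) ys))
        (cong₂ _+_ (length-map (x ,_) ys) (length-cartesianProduct xs ys))

m*n*n≤o*o⇒o<n⇒m≡0 : ∀ m {n o} → m * n * n ≤ o * o → o < n → m ≡ 0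
m*n*n≤o*o⇒o<n⇒m≡0 zero _ _ = refl
m*n*n≤o*o⇒o<n⇒m≡0 (suc k) {n} bound o<n =
  ⊥-elim (<⇒≱ (*-mono-< o<n o<n) (≤-trans (*-monoˡ-≤ n (m≤m+n n (k * n))) bound))

4*m≤n⇒m<n : ∀ {m n} → 0 < n → 4 * m ≤ n → m < n
4*m≤n⇒m<n {zero} 0<n _ = 0<n
4*m≤n⇒m<n {suc m} _ 4m≤n = <-≤-trans (m<m+n (suc m) (s≤s z≤n)) 4m≤n

4*m≤2⇒m≡0 : ∀ {m} → 4 * m ≤ 2 → m ≡ 0
4*m≤2⇒m≡0 {zero} _ = refl
4*m≤2⇒m≡0 {suc m} 4m≤2 with ≤-trans (m≤m*n 4 (suc m)) 4m≤2
... | s≤s (s≤s ())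

module _ {n m K : ℕ} (H : HashFamily n m K) where

  Collision : Fin K → BitVec n × BitVec n → Set
  Collision i p = H i (proj₁ p) ≡ H i (proj₂ p)

  collision? : ∀ i p → Dec (Collision i p)
  collision? i p = H i (proj₁ p) ≟v H i (proj₂ p)

  Distinct : BitVec n × BitVec n → Set
  Distinct p = proj₁ p ≢ proj₂ p

  FewCollisions : List (BitVec n × BitVec n) → Fin K → Set
  FewCollisions ps i = length (filter (collision? i) ps) * 2 ^ m ≤ length ps

  SeparatedBy : Formula n → Fin K → Fin K → Set
  SeparatedBy F i j = ∀ {z₁ z₂} → F z₁ ≡ true → F z₂ ≡ true → z₁ ≢ z₂ →
    H i z₁ ≡ H i z₂ → H j z₁ ≢ H j z₂

  phiStock-unsatisfiable : Fin m → Fin K → (F : Formula n) → #sat F ≡ 0 → phiStock H F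
  phiStock-unsatisfiable slot i F #sat≡0 = (λ _ → i) , λ z₁ z₂ → slot , λ (F[z₁] , _) →
    ⊥-elim (n≮0 (subst (0 <_) #sat≡0
      (filter-some (λ x → F x Bool.≟ true) (lose (∈-allBitVecs z₁) F[z₁]))))

  module _ (independent : PairwiseIndependent H) where

    length-collisions-*2^m : ∀ {p} → Distinct p →
      length (filter (λ i → collision? i p) (allFin K)) * 2 ^ m ≡ K
    length-collisions-*2^m {y₁ , y₂} y₁≢y₂ = *-cancelʳ-≡ _ _ (2 ^ m) {{m^n≢0 2 m}} (begin
      collisions * 2 ^ m * 2 ^ m
        ≡⟨ *-assoc collisions (2 ^ m) (2 ^ m) ⟩
      collisions * (2 ^ m * 2 ^ m)
        ≡⟨ cong₂ _*_ collisions≡sum 2^m*2^m≡2^[2*m] ⟩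
      sum (map (λ α → length (filter (R? α) (allFin K))) (allBitVecs m)) * 2 ^ (2 * m)
        ≡⟨ sum-map-*≡length-* (λ α → length (filter (R? α) (allFin K))) (2 ^ (2 * m)) K
             (All.universal (λ α → independent y₁ y₂ y₁≢y₂ α α) (allBitVecs m)) ⟩
      length (allBitVecs m) * K
        ≡⟨ cong (_* K) (length-allBitVecs m) ⟩
      2 ^ m * K
        ≡⟨ *-comm (2 ^ m) K ⟩
      K * 2 ^ m ∎)
      where
      open ≡-Reasoning
      collisions : ℕ
      collisions = length (filter (λ i → H i y₁ ≟v H i y₂) (allFin K))
      R? : ∀ α i → Dec (H i y₁ ≡ α × H i y₂ ≡ α)
      R? α i = (H i y₁ ≟v α) ×-dec (H i y₂ ≟v α)
      2^m*2^m≡2^[2*m] : 2 ^ m * 2 ^ m ≡ 2 ^ (2 * m)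
      2^m*2^m≡2^[2*m] = trans (sym (^-distribˡ-+-* 2 m m)) (cong (λ k → 2 ^ (m + k)) (sym (+-identityʳ m)))
      collisions≡sum : collisions ≡ sum (map (λ α → length (filter (R? α) (allFin K))) (allBitVecs m))
      collisions≡sum = begin
        collisions
          ≡⟨ length-filter≡sum-indicator (λ i → H i y₁ ≟v H i y₂) (allFin K) ⟩
        sum (map (λ i → indicator (H i y₁ ≟v H i y₂)) (allFin K))
          ≡⟨ cong sum (map-cong (λ i → length-filter-diagonal _≟v_ (allBitVecs-unique m)
                                                               (∈-allBitVecs (H i y₁)))
                                (allFin K)) ⟨
        sum (map (λ i → length (filter (λ α → R? α i) (allBitVecs m))) (allFin K))
          ≡⟨ length-filter-comm R? (allBitVecs m) (allFin K) ⟨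
        sum (map (λ α → length (filter (R? α) (allFin K))) (allBitVecs m)) ∎

    ∃-few-collisions : 1 ≤ K → ∀ {ps} → All Distinct ps → ∃ (FewCollisions ps)
    ∃-few-collisions (s≤s _) {ps} distinct
      with Any.satisfied
             (min≤average (λ i → length (filter (collision? i) ps)) Fin.zero (tabulate Fin.suc))
    ... | i , K*cᵢ≤total = i , *-cancelˡ-≤ K (begin
      K * (collisions i * 2 ^ m)
        ≡⟨ *-assoc K (collisions i) (2 ^ m) ⟨
      K * collisions i * 2 ^ m
        ≤⟨ *-monoˡ-≤ (2 ^ m) (subst (λ L → L * collisions i ≤ sum (map collisions (allFin K)))
                                     (length-tabulate {n = K} id) K*cᵢ≤total) ⟩
      sum (map collisions (allFin K)) * 2 ^ m
        ≡⟨ cong (_* 2 ^ m) (length-filter-comm collision? (allFin K) ps) ⟩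
      sum (map (λ p → length (filter (λ i → collision? i p) (allFin K))) ps) * 2 ^ m
        ≡⟨ sum-map-*≡length-* _ (2 ^ m) K (All.map length-collisions-*2^m distinct) ⟩
      length ps * K
        ≡⟨ *-comm (length ps) K ⟩
      K * length ps ∎)
      where
      open ≤-Reasoning
      collisions : Fin K → ℕ
      collisions i = length (filter (collision? i) ps)

    ∃-separating : 1 ≤ K → (F : Formula n) → #sat F < 2 ^ m → ∃₂ (SeparatedBy F)
    ∃-separating K≥1 F #sat<2^m = i , j , separated
      where
      satisfying : List (BitVec n)
      satisfying = filter (λ x → F x Bool.≟ true) (allBitVecs n)
      pairs₀ pairs₁ pairs₂ : List (BitVec n × BitVec n)
      pairs₀ = filter (¬? ∘ uncurry _≟v_) (cartesianProduct satisfying satisfying)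
      distinct₀ : All Distinct pairs₀
      distinct₀ = all-filter (¬? ∘ uncurry _≟v_) (cartesianProduct satisfying satisfying)
      round₁ : ∃ (FewCollisions pairs₀)
      round₁ = ∃-few-collisions K≥1 distinct₀
      i : Fin K
      i = proj₁ round₁
      pairs₁ = filter (collision? i) pairs₀
      round₂ : ∃ (FewCollisions pairs₁)
      round₂ = ∃-few-collisions K≥1 (filter⁺ (collision? i) distinct₀)
      j : Fin K
      j = proj₁ round₂
      pairs₂ = filter (collision? j) pairs₁
      length-pairs₀ : length pairs₀ ≤ #sat F * #sat F
      length-pairs₀ = ≤-trans (length-filter (¬? ∘ uncurry _≟v_) (cartesianProduct satisfying satisfying))
                              (≤-reflexive (length-cartesianProduct satisfying satisfying))
      pairs₂-empty : length pairs₂ ≡ 0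
      pairs₂-empty = m*n*n≤o*o⇒o<n⇒m≡0 (length pairs₂)
        (≤-trans (*-monoˡ-≤ (2 ^ m) (proj₂ round₂)) (≤-trans (proj₂ round₁) length-pairs₀))
        #sat<2^m
      separated : SeparatedBy F i j
      separated {z₁} {z₂} F[z₁] F[z₂] z₁≢z₂ cᵢ cⱼ =
        n≮0 (subst (0 <_) pairs₂-empty (filter-some (collision? j) (lose z₁z₂∈pairs₁ cⱼ)))
        where
        z₁z₂∈pairs₁ : (z₁ , z₂) ∈ pairs₁
        z₁z₂∈pairs₁ = ∈-filter⁺ (collision? i)
          (∈-filter⁺ (¬? ∘ uncurry _≟v_)
            (∈-cartesianProduct⁺ (∈-filter⁺ (λ x → F x Bool.≟ true) (∈-allBitVecs z₁) F[z₁])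
                                 (∈-filter⁺ (λ x → F x Bool.≟ true) (∈-allBitVecs z₂) F[z₂]))
            z₁≢z₂)
          cᵢ

phiStock-separated : ∀ {n m K} (H : HashFamily n (suc (suc m)) K) {F : Formula n} {i j} →
  SeparatedBy H F i j → phiStock H F
phiStock-separated {m = m} {K} H {F} {i} {j} separated = slot , choose
  where
  slot : Fin (suc (suc m)) → Fin K
  slot Fin.zero = i
  slot (Fin.suc _) = j
  choose : ∀ z₁ z₂ → Σ (Fin (suc (suc m))) λ k →
    (F z₁ ≡ true × z₁ ≢ z₂ × H (slot k) z₁ ≡ H (slot k) z₂) → F z₂ ≡ false
  choose z₁ z₂ with H i z₁ ≟v H i z₂
  ... | no ¬cᵢ = Fin.zero , λ (_ , _ , cᵢ) → ⊥-elim (¬cᵢ cᵢ)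
  ... | yes cᵢ = Fin.suc Fin.zero , λ (F[z₁] , z₁≢z₂ , cⱼ) →
    ¬-not (λ F[z₂] → separated F[z₁] F[z₂] z₁≢z₂ cᵢ cⱼ)

lemma3p2 : (n m : ℕ) → 1 ≤ m → m ≤ n →
    (K : ℕ) → 1 ≤ K → (H : HashFamily n m K) → PairwiseIndependent H →
    (F : Formula n) → 4 * #sat F ≤ 2 ^ m →
    phiStock H F
lemma3p2 n zero () _ _ _ _ _ _ _
lemma3p2 n (suc zero) _ _ zero () _ _ _ _
lemma3p2 n (suc zero) _ _ (suc k) _ H _ F 4*#sat≤2 =
  phiStock-unsatisfiable H Fin.zero Fin.zero F (4*m≤2⇒m≡0 4*#sat≤2)
lemma3p2 n m@(suc (suc _)) _ _ K K≥1 H independent F 4*#sat≤2^m =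
  let _ , _ , separated = ∃-separating H independent K≥1 F #sat<2^m in phiStock-separated H separated
  where
  #sat<2^m : #sat F < 2 ^ m
  #sat<2^m = 4*m≤n⇒m<n (m^n>0 2 m) 4*#sat≤2^m
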